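{- For every integer $n\ge1$, there exists a string $S^{\mathtt{p}}_n\in\mathcal{S}^{\mathtt{p}}_n$ satisfying $\mathsf{slp}(S^{\mathtt{p}}_n)=\Omega(\log^2 n/\log\log n)$.
   Context: $\mathcal{S}^{\mathtt{p}}_n$ is the set of length-$n$ prefixes of all infinite strings $T$ over $\{\mathtt{a},\mathtt{b}\}$ such that the first $\mathtt{b}$ of $T$ is at $T[1]$ and, for each $j\ge2$, the $j$th $\mathtt{b}$ lies somewhere in $T[2\cdot4^{j-2}+1\mathinner{.\,.} 4^{j-1}]$. A straight-line program (SLP) is a context-free grammar generating exactly one string in which every rule has a right-hand side of exactly two symbols; $\mathsf{slp}(S)$ is the minimum number of symbols (terminals and nonterminals) in an SLP generating $S$. Logarithms are base 2; $\Omega$ hides a universal constant. -}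

module Defs where

open import Data.Nat using (ℕ; zero; suc; _+_; _*_; _^_; _≤_)
open import Data.Nat.Logarithm using (⌊log₂_⌋)
open import Data.Fin using (Fin; zero; suc)
open import Data.Vec using (Vec; []; _∷_; lookup)
open import Data.List using (List; []; _∷_; _++_; map; upTo)
open import Data.Bool using (Bool; true; false; _∨_; if_then_else_)
open import Data.Sum using (_⊎_; inj₁; inj₂)
open import Data.Product using (Σ; _×_; _,_; ∃; proj₁; proj₂)
open import Relation.Binary.PropositionalEquality using (_≡_)

data Σab : Set where
  a b : Σab

Str : Set
Str = List Σab

-- The family S^p_n.
-- An infinite string T is a function ℕ → Σab, 0-based: T[i] (1-based) = T (i - 1).

isB : Σab → Bool
isB a = false
isB b = true

countB : (ℕ → Σab) → ℕ → ℕ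
countB T zero    = 0
countB T (suc k) = countB T k + (if isB (T k) then 1 else 0)

-- Allowed (1-based) position p = suc q of the (j+1)-th b:
--   j = 0      : p = 1
--   j = suc k  : (j+1 = k+2)  2·4^k + 1 ≤ p ≤ 4^(k+1)
Allowed : ℕ → ℕ → Set
Allowed zero    q = q ≡ 0
Allowed (suc k) q = (2 * 4 ^ k + 1 ≤ suc q) × (suc q ≤ 4 ^ suc k)

ValidT : (ℕ → Σab) → Set
ValidT T = ∀ j → ∃ λ q → (T q ≡ b) × (countB T q ≡ j) × Allowed j q

prefix : (ℕ → Σab) → ℕ → Str
prefix T n = map T (upTo n)

InSp : ℕ → Str → Set
InSp n S = ∃ λ T → ValidT T × (prefix T n ≡ S)

Sym : ℕ → Set
Sym m = Σab ⊎ Fin m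

-- A grammar with m nonterminals, built by adding rules X → Y Z one at a time;
-- the right-hand side of a new rule may only use previously introduced
-- nonterminals (acyclicity). The newest nonterminal has index zero.
data Grammar : ℕ → Set where
  []  : Grammar 0
  _▷_ : ∀ {m} → Grammar m → Sym m × Sym m → Grammar (suc m)

symExp : ∀ {m} → Vec Str m → Sym m → Str
symExp v (inj₁ c) = c ∷ []
symExp v (inj₂ i) = lookup v i

exps : ∀ {m} → Grammar m → Vec Str m
exps []          = []
exps (G ▷ (x , y)) = let v = exps G in (symExp v x ++ symExp v y) ∷ exps G

record SLP : Set where
  constructor slp
  field
    nNT   : ℕ
    rules : Grammar nNT
    start : Sym nNT

open SLP public

generated : SLP → Str
generated P = symExp (exps (rules P)) (start P)

symUses : ∀ {m} → Σab → Sym m → Bool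
symUses a (inj₁ a) = true
symUses b (inj₁ b) = true
symUses _ _        = false

grUses : ∀ {m} → Σab → Grammar m → Bool
grUses c []            = false
grUses c (G ▷ (x , y)) = grUses c G ∨ symUses c x ∨ symUses c y

uses : Σab → SLP → Bool
uses c P = grUses c (rules P) ∨ symUses c (start P)

size : SLP → ℕ
size P = nNT P + (if uses a P then 1 else 0) + (if uses b P then 1 else 0)

-- Put the b's of T at 0-based positions 0 and 2·4^k + d k with 0 ≤ d k < 2·4^k:
-- every such T satisfies the constraints, and the offsets d k for k < J are
-- recovered from the prefix of length 4^J.  So for n ≥ 4^J the family S^p_n
-- contains 2^(J²) distinct strings, while there are at most (s+2)^(2s+2) SLPs
-- with at most s nonterminals.  With J = ⌊log n / 2⌋ and
-- s = ⌊log² n / (100 log log n)⌋ the SLPs are outnumbered, so some string of the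
-- family needs more than s nonterminals.
module Submission where

open import Defs
open import Data.List using (List; []; _∷_; _++_; map; upTo; applyUpTo; length; cartesianProduct; cartesianProductWith; allFin)
open import Data.List.Properties using (∷-injective; map-upTo; length-map; length-++; length-tabulate; length-upTo; length-removeAt′; ≡-dec)
open import Data.List.Membership.Propositional using (_∈_; _─_; find; lose)
open import Data.List.Membership.Propositional.Properties using (∈-upTo⁺; ∈-upTo⁻; ∈-cartesianProductWith⁺; ∈-cartesianProductWith⁻; ∈-cartesianProduct⁺; ∈-map⁺; ∈-allFin; ∈-++⁺ˡ; ∈-++⁺ʳ)
open import Data.List.Relation.Unary.All using ([]; all?)
import Data.List.Relation.Unary.All as All
open import Data.List.Relation.Unary.All.Properties using (¬All⇒Any¬)
open import Data.List.Relation.Unary.AllPairs using ([]; _∷_)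
open import Data.List.Relation.Unary.Any using (here; there; any?)
open import Data.List.Relation.Unary.Unique.Propositional using (Unique)
open import Data.List.Relation.Unary.Unique.Propositional.Properties using (upTo⁺; cartesianProductWith⁺)
open import Data.Nat using (ℕ; zero; suc; _+_; _*_; _^_; _≤_; _<_; _≟_; _<?_; _≤?_; z≤n; s≤s; z<s; NonZero; >-nonZero; ⌊_/2⌋; ⌈_/2⌉; _/_; _%_)
open import Data.Nat.Properties
open import Data.Nat.DivMod using (m≡m%n+[m/n]*n; m%n<n; m/n*n≤m; m/n≤m)
open import Data.Nat.Induction using (<-rec)
open import Data.Nat.Logarithm using (⌊log₂_⌋; ⌊log₂⌋-mono-≤; ⌊log₂[2^n]⌋≡n)
open import Data.Nat.Logarithm.Core using (⌊log2⌋-acc-irrelevant)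
open import Data.Nat.Tactic.RingSolver using (solve-∀)
open import Data.Product using (_×_; _,_; ∃; proj₁; proj₂)
open import Data.Sum using (_⊎_; inj₁; inj₂)
open import Relation.Binary using (tri<; tri≈; tri>)
open import Relation.Binary.Definitions using (DecidableEquality)
open import Relation.Binary.PropositionalEquality using (_≡_; _≢_; refl; sym; trans; cong; cong₂; subst; module ≡-Reasoning)
open import Relation.Nullary using (yes; no; contradiction)
open import Relation.Nullary.Decidable using (from-yes)

n<2^n : ∀ n → n < 2 ^ n
n<2^n zero    = z<s
n<2^n (suc n) = ≤-trans (+-mono-≤ (m^n>0 2 n) (n<2^n n))
                        (≤-reflexive (cong (2 ^ n +_) (sym (+-identityʳ (2 ^ n)))))

⌊log₂n⌋≤n : ∀ n → ⌊log₂ n ⌋ ≤ n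
⌊log₂n⌋≤n n = subst (⌊log₂ n ⌋ ≤_) (⌊log₂[2^n]⌋≡n n) (⌊log₂⌋-mono-≤ (<⇒≤ (n<2^n n)))

2^k≤n⇒k≤⌊log₂n⌋ : ∀ {k n} → 2 ^ k ≤ n → k ≤ ⌊log₂ n ⌋
2^k≤n⇒k≤⌊log₂n⌋ {k} 2^k≤n = subst (_≤ _) (⌊log₂[2^n]⌋≡n k) (⌊log₂⌋-mono-≤ 2^k≤n)

n<2^[1+⌊log₂n⌋] : ∀ n → n < 2 ^ suc ⌊log₂ n ⌋
n<2^[1+⌊log₂n⌋] n with n <? 2 ^ suc ⌊log₂ n ⌋
... | yes n< = n<
... | no  n≮ = contradiction (2^k≤n⇒k≤⌊log₂n⌋ (≮⇒≥ n≮)) (<-irrefl refl)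

2*⌊n/2⌋≤n : ∀ n → 2 * ⌊ n /2⌋ ≤ n
2*⌊n/2⌋≤n n = begin
  2 * ⌊ n /2⌋        ≡⟨ cong (⌊ n /2⌋ +_) (+-identityʳ ⌊ n /2⌋) ⟩
  ⌊ n /2⌋ + ⌊ n /2⌋  ≤⟨ +-monoʳ-≤ ⌊ n /2⌋ (⌊n/2⌋≤⌈n/2⌉ n) ⟩
  ⌊ n /2⌋ + ⌈ n /2⌉  ≡⟨ ⌊n/2⌋+⌈n/2⌉≡n n ⟩
  n                  ∎
  where open ≤-Reasoning

n≤2*⌊n/2⌋+1 : ∀ n → n ≤ 2 * ⌊ n /2⌋ + 1
n≤2*⌊n/2⌋+1 n = begin
  n                      ≡⟨ ⌊n/2⌋+⌈n/2⌉≡n n ⟨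
  ⌊ n /2⌋ + ⌈ n /2⌉      ≤⟨ +-monoʳ-≤ ⌊ n /2⌋ (⌊n/2⌋-mono (n≤1+n (suc n))) ⟩
  ⌊ n /2⌋ + suc ⌊ n /2⌋  ≡⟨ h+[1+h]≡2h+1 ⌊ n /2⌋ ⟩
  2 * ⌊ n /2⌋ + 1        ∎
  where
  open ≤-Reasoning
  h+[1+h]≡2h+1 : ∀ h → h + suc h ≡ 2 * h + 1
  h+[1+h]≡2h+1 = solve-∀

2^⌊log₂n⌋≤n : ∀ n → 0 < n → 2 ^ ⌊log₂ n ⌋ ≤ n
2^⌊log₂n⌋≤n = <-rec _ step
  where
  step : ∀ n → (∀ {m} → m < n → 0 < m → 2 ^ ⌊log₂ m ⌋ ≤ m) → 0 < n → 2 ^ ⌊log₂ n ⌋ ≤ n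
  step 1                  _   _ = ≤-refl
  step n@(suc (suc m)) rec _ = begin
    2 ^ ⌊log₂ n ⌋            ≡⟨ cong (λ e → 2 ^ suc e) (⌊log2⌋-acc-irrelevant (suc ⌊ m /2⌋)) ⟩
    2 * 2 ^ ⌊log₂ ⌊ n /2⌋ ⌋  ≤⟨ *-monoʳ-≤ 2 (rec (⌊n/2⌋<n (suc m)) z<s) ⟩
    2 * ⌊ n /2⌋              ≤⟨ 2*⌊n/2⌋≤n n ⟩
    n                        ∎
    where open ≤-Reasoning

m<[1+m/n]*n : ∀ m n .{{_ : NonZero n}} → m < suc (m / n) * n
m<[1+m/n]*n m n = begin-strict
  m                  ≡⟨ m≡m%n+[m/n]*n m n ⟩
  m % n + m / n * n  <⟨ +-monoˡ-< (m / n * n) (m%n<n m n) ⟩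
  n + m / n * n      ∎
  where open ≤-Reasoning

4^k≡2^[2k] : ∀ k → 4 ^ k ≡ 2 ^ (2 * k)
4^k≡2^[2k] = ^-*-assoc 2 2

k<4^k : ∀ k → k < 4 ^ k
k<4^k k = ≤-trans (n<2^n k) (^-monoˡ-≤ k (s≤s (s≤s z≤n)))

-- The infinite strings

InBlock : ℕ → ℕ → Set
InBlock k i = 4 ^ k ≤ i × i < 4 ^ suc k

InBlock-unique : ∀ {k k′ i} → InBlock k i → InBlock k′ i → k ≡ k′
InBlock-unique {k} {k′} (lo , hi) (lo′ , hi′) with <-cmp k k′
... | tri≈ _ k≡k′ _ = k≡k′
... | tri< k<k′ _ _ = contradiction (<-≤-trans hi (≤-trans (^-monoʳ-≤ 4 k<k′) lo′)) (<-irrefl refl)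
... | tri> _ _ k′<k = contradiction (<-≤-trans hi′ (≤-trans (^-monoʳ-≤ 4 k′<k) lo)) (<-irrefl refl)

bPos : (ℕ → ℕ) → ℕ → ℕ
bPos d k = 2 * 4 ^ k + d k

4^k≤bPos : ∀ d k → 4 ^ k ≤ bPos d k
4^k≤bPos d k = ≤-trans (m≤m+n (4 ^ k) _) (m≤m+n (2 * 4 ^ k) (d k))

k<bPos : ∀ d k → k < bPos d k
k<bPos d k = <-≤-trans (k<4^k k) (4^k≤bPos d k)

-- Only k < i need be searched, since k < bPos d k.
digitString : (ℕ → ℕ) → ℕ → Σab
digitString d zero = b
digitString d (suc i) with any? (λ k → suc i ≟ bPos d k) (upTo (suc i))
... | yes _ = b
... | no  _ = a

digitString-bPos : ∀ d k → digitString d (bPos d k) ≡ b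
digitString-bPos d k = at (k<bPos d k) refl
  where
  at : ∀ {i} → k < i → i ≡ bPos d k → digitString d i ≡ b
  at {suc i} k<i i≡bPos with any? (λ k → suc i ≟ bPos d k) (upTo (suc i))
  ... | yes _ = refl
  ... | no ∄k = contradiction (lose (∈-upTo⁺ k<i) i≡bPos) ∄k

digitString-b⁻ : ∀ d i → digitString d i ≡ b → i ≡ 0 ⊎ ∃ λ k → i ≡ bPos d k
digitString-b⁻ d zero    _ = inj₁ refl
digitString-b⁻ d (suc i) _ with any? (λ k → suc i ≟ bPos d k) (upTo (suc i))
digitString-b⁻ d (suc i) _  | yes ∃k = let (k , _ , i≡bPos) = find ∃k in inj₂ (k , i≡bPos)
digitString-b⁻ d (suc i) () | no _

countB-b : ∀ T i → T i ≡ b → countB T (suc i) ≡ suc (countB T i)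
countB-b T i Ti≡b rewrite Ti≡b = +-comm (countB T i) 1

countB-a : ∀ T i → T i ≡ a → countB T (suc i) ≡ countB T i
countB-a T i Ti≡a rewrite Ti≡a = +-identityʳ (countB T i)

countB-aRun : ∀ T {x y} → x ≤ y → (∀ {i} → x ≤ i → i < y → T i ≡ a) → countB T y ≡ countB T x
countB-aRun T {y = zero}  z≤n _ = refl
countB-aRun T {y = suc y} x≤1+y all-a with m≤n⇒m<n∨m≡n x≤1+y
... | inj₂ refl      = refl
... | inj₁ (s≤s x≤y) = trans (countB-a T y (all-a x≤y ≤-refl))
                             (countB-aRun T x≤y (λ x≤i i<y → all-a x≤i (m<n⇒m<1+n i<y)))

module _ {d : ℕ → ℕ} (d<2*4^ : ∀ k → d k < 2 * 4 ^ k) where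

  bPos-InBlock : ∀ k → InBlock k (bPos d k)
  bPos-InBlock k = 4^k≤bPos d k
                 , <-≤-trans (+-monoʳ-< (2 * 4 ^ k) (d<2*4^ k)) (≤-reflexive (2x+2x≡4x (4 ^ k)))
    where
    2x+2x≡4x : ∀ x → 2 * x + 2 * x ≡ 4 * x
    2x+2x≡4x = solve-∀

  digitString-b-InBlock : ∀ {k i} → InBlock k i → digitString d i ≡ b → i ≡ bPos d k
  digitString-b-InBlock {k} {i} i∈k Ti≡b with digitString-b⁻ d i Ti≡b
  ... | inj₁ refl = contradiction (proj₁ i∈k) (<⇒≱ (m^n>0 4 k))
  ... | inj₂ (k′ , i≡bPos) with InBlock-unique {k} {k′} i∈k (subst (InBlock k′) (sym i≡bPos) (bPos-InBlock k′))
  ...   | refl = i≡bPos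

  digitString-a-InBlock : ∀ {k i} → InBlock k i → i ≢ bPos d k → digitString d i ≡ a
  digitString-a-InBlock {k} {i} i∈k i≢bPos with digitString d i in Ti
  ... | a = refl
  ... | b = contradiction (digitString-b-InBlock i∈k Ti) i≢bPos

  countB-4^ : ∀ k → countB (digitString d) (4 ^ k) ≡ suc k
  countB-bPos : ∀ k → countB (digitString d) (bPos d k) ≡ suc k

  countB-4^ zero    = refl
  countB-4^ (suc k) = begin
    countB T (4 ^ suc k)       ≡⟨ countB-aRun T (proj₂ (bPos-InBlock k)) after-bPos ⟩
    countB T (suc (bPos d k))  ≡⟨ countB-b T (bPos d k) (digitString-bPos d k) ⟩
    suc (countB T (bPos d k))  ≡⟨ cong suc (countB-bPos k) ⟩
    suc (suc k)                ∎
    where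
    open ≡-Reasoning
    T : ℕ → Σab
    T = digitString d
    after-bPos : ∀ {i} → bPos d k < i → i < 4 ^ suc k → T i ≡ a
    after-bPos p<i i<4^ = digitString-a-InBlock (≤-trans (proj₁ (bPos-InBlock k)) (<⇒≤ p<i) , i<4^) (>⇒≢ p<i)

  countB-bPos k = trans (countB-aRun (digitString d) (proj₁ (bPos-InBlock k)) before-bPos) (countB-4^ k)
    where
    before-bPos : ∀ {i} → 4 ^ k ≤ i → i < bPos d k → digitString d i ≡ a
    before-bPos 4^≤i i<p = digitString-a-InBlock (4^≤i , <-trans i<p (proj₂ (bPos-InBlock k))) (<⇒≢ i<p)

  digitString-valid : ValidT (digitString d)
  digitString-valid zero    = 0 , refl , refl , refl
  digitString-valid (suc k) = bPos d k , digitString-bPos d k , countB-bPos k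
                            , ≤-trans (≤-reflexive (+-comm (2 * 4 ^ k) 1)) (s≤s (m≤m+n (2 * 4 ^ k) (d k)))
                            , proj₂ (bPos-InBlock k)

-- Digit vectors and the strings they determine

-- The head of x ∷ v is the digit of index length v; digits past the end are 0.
digit : List ℕ → ℕ → ℕ
digit []      k = 0
digit (x ∷ v) k with k ≟ length v
... | yes _ = x
... | no  _ = digit v k

digit-top : ∀ x v → digit (x ∷ v) (length v) ≡ x
digit-top x v with length v ≟ length v
... | yes _ = refl
... | no  ≢|v| = contradiction refl ≢|v|

digit-below : ∀ x v {k} → k ≢ length v → digit (x ∷ v) k ≡ digit v k
digit-below x v {k} k≢ with k ≟ length v
... | yes k≡ = contradiction k≡ k≢
... | no  _ = refl

digit-injective : ∀ {v w} → length v ≡ length w → (∀ {k} → k < length v → digit v k ≡ digit w k) → v ≡ w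
digit-injective {[]}    {[]}    _   _     = refl
digit-injective {x ∷ v} {y ∷ w} |v|≡|w|+1 agree = cong₂ _∷_ x≡y (digit-injective |v|≡|w| agree′)
  where
  |v|≡|w| : length v ≡ length w
  |v|≡|w| = suc-injective |v|≡|w|+1
  x≡y : x ≡ y
  x≡y = begin
    x                        ≡⟨ digit-top x v ⟨
    digit (x ∷ v) (length v) ≡⟨ agree ≤-refl ⟩
    digit (y ∷ w) (length v) ≡⟨ cong (digit (y ∷ w)) |v|≡|w| ⟩
    digit (y ∷ w) (length w) ≡⟨ digit-top y w ⟩
    y                        ∎
    where open ≡-Reasoning
  agree′ : ∀ {k} → k < length v → digit v k ≡ digit w k
  agree′ {k} k<|v| = begin
    digit v k       ≡⟨ digit-below x v (<⇒≢ k<|v|) ⟨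
    digit (x ∷ v) k ≡⟨ agree (m<n⇒m<1+n k<|v|) ⟩
    digit (y ∷ w) k ≡⟨ digit-below y w (subst (k ≢_) |v|≡|w| (<⇒≢ k<|v|)) ⟩
    digit w k       ∎
    where open ≡-Reasoning

digitVectors : ℕ → List (List ℕ)
digitVectors zero    = [] ∷ []
digitVectors (suc J) = cartesianProductWith _∷_ (upTo (2 * 4 ^ J)) (digitVectors J)

∈digitVectors⁻ : ∀ J {v} → v ∈ digitVectors J → length v ≡ J × (∀ k → digit v k < 2 * 4 ^ k)
∈digitVectors⁻ zero    (here refl) = refl , λ k → ≤-trans (m^n>0 4 k) (m≤m+n (4 ^ k) _)
∈digitVectors⁻ (suc J) v∈ with ∈-cartesianProductWith⁻ _∷_ (upTo (2 * 4 ^ J)) (digitVectors J) v∈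
... | x , w , x∈ , w∈ , refl with ∈digitVectors⁻ J w∈
...   | |w|≡J , w-bounded = cong suc |w|≡J , bounded
  where
  bounded : ∀ k → digit (x ∷ w) k < 2 * 4 ^ k
  bounded k with k ≟ length w
  ... | yes k≡|w| = subst (λ j → x < 2 * 4 ^ j) (sym (trans k≡|w| |w|≡J)) (∈-upTo⁻ x∈)
  ... | no  _     = w-bounded k

digitVectors-unique : ∀ J → Unique (digitVectors J)
digitVectors-unique zero    = [] ∷ []
digitVectors-unique (suc J) = cartesianProductWith⁺ _∷_ ∷-injective (upTo⁺ (2 * 4 ^ J)) (digitVectors-unique J)

length-cartesianProductWith : ∀ {A B C : Set} (f : A → B → C) xs ys →
  length (cartesianProductWith f xs ys) ≡ length xs * length ys
length-cartesianProductWith f []       ys = refl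
length-cartesianProductWith f (x ∷ xs) ys =
  trans (length-++ (map (f x) ys)) (cong₂ _+_ (length-map (f x) ys) (length-cartesianProductWith f xs ys))

length-digitVectors : ∀ J → length (digitVectors J) ≡ 2 ^ (J * J)
length-digitVectors zero    = refl
length-digitVectors (suc J) = begin
  length (digitVectors (suc J))                ≡⟨ length-cartesianProductWith _∷_ (upTo (2 * 4 ^ J)) (digitVectors J) ⟩
  length (upTo (2 * 4 ^ J)) * length (digitVectors J)
                                               ≡⟨ cong₂ _*_ (trans (length-upTo _) (cong (2 *_) (4^k≡2^[2k] J))) (length-digitVectors J) ⟩
  2 ^ suc (2 * J) * 2 ^ (J * J)                ≡⟨ ^-distribˡ-+-* 2 (suc (2 * J)) (J * J) ⟨
  2 ^ (suc (2 * J) + J * J)                    ≡⟨ cong (2 ^_) (1+2J+J*J≡[1+J]*[1+J] J) ⟩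
  2 ^ (suc J * suc J)                          ∎
  where
  open ≡-Reasoning
  1+2J+J*J≡[1+J]*[1+J] : ∀ J → suc (2 * J) + J * J ≡ suc J * suc J
  1+2J+J*J≡[1+J]*[1+J] = solve-∀

applyUpTo-≡⇒ : ∀ {A : Set} {n} (f g : ℕ → A) → applyUpTo f n ≡ applyUpTo g n → ∀ {i} → i < n → f i ≡ g i
applyUpTo-≡⇒ {n = suc n} f g fs≡gs {zero}  _         = proj₁ (∷-injective fs≡gs)
applyUpTo-≡⇒ {n = suc n} f g fs≡gs {suc i} (s≤s i<n) =
  applyUpTo-≡⇒ (λ j → f (suc j)) (λ j → g (suc j)) (proj₂ (∷-injective fs≡gs)) i<n

prefix-≡⇒ : ∀ {n} T T′ → prefix T n ≡ prefix T′ n → ∀ {i} → i < n → T i ≡ T′ i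
prefix-≡⇒ {n} T T′ eq = applyUpTo-≡⇒ T T′ (trans (sym (map-upTo T n)) (trans eq (map-upTo T′ n)))

candidate : ℕ → List ℕ → Str
candidate n v = prefix (digitString (digit v)) n

candidate-InSp : ∀ J {n v} → v ∈ digitVectors J → InSp n (candidate n v)
candidate-InSp J v∈ = _ , digitString-valid (proj₂ (∈digitVectors⁻ J v∈)) , refl

candidate-injective : ∀ J {n v w} → 4 ^ J ≤ n → v ∈ digitVectors J → w ∈ digitVectors J →
                      candidate n v ≡ candidate n w → v ≡ w
candidate-injective J {n} {v} {w} 4^J≤n v∈ w∈ same = digit-injective (trans |v|≡J (sym |w|≡J)) agree
  where
  |v|≡J : length v ≡ J
  |v|≡J = proj₁ (∈digitVectors⁻ J v∈)
  |w|≡J : length w ≡ J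
  |w|≡J = proj₁ (∈digitVectors⁻ J w∈)
  v-bounded : ∀ k → digit v k < 2 * 4 ^ k
  v-bounded = proj₂ (∈digitVectors⁻ J v∈)
  w-bounded : ∀ k → digit w k < 2 * 4 ^ k
  w-bounded = proj₂ (∈digitVectors⁻ J w∈)
  agree : ∀ {k} → k < length v → digit v k ≡ digit w k
  agree {k} k<|v| = +-cancelˡ-≡ (2 * 4 ^ k) (digit v k) (digit w k)
    (digitString-b-InBlock w-bounded p∈k (trans (sym (prefix-≡⇒ _ _ same p<n)) (digitString-bPos (digit v) k)))
    where
    p∈k : InBlock k (bPos (digit v) k)
    p∈k = bPos-InBlock v-bounded k
    p<n : bPos (digit v) k < n
    p<n = <-≤-trans (proj₂ p∈k) (≤-trans (^-monoʳ-≤ 4 (subst (k <_) |v|≡J k<|v|)) 4^J≤n)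

-- Counting straight-line programs

symbols : ∀ m → List (Sym m)
symbols m = inj₁ a ∷ inj₁ b ∷ map inj₂ (allFin m)

∈symbols : ∀ {m} (x : Sym m) → x ∈ symbols m
∈symbols (inj₁ a) = here refl
∈symbols (inj₁ b) = there (here refl)
∈symbols (inj₂ i) = there (there (∈-map⁺ inj₂ (∈-allFin i)))

length-symbols : ∀ m → length (symbols m) ≡ 2 + m
length-symbols m = cong (2 +_) (trans (length-map inj₂ (allFin m)) (length-tabulate {n = m} (λ i → i)))

grammars : ∀ m → List (Grammar m)
grammars zero    = [] ∷ []
grammars (suc m) = cartesianProductWith _▷_ (grammars m) (cartesianProduct (symbols m) (symbols m))

∈grammars : ∀ {m} (G : Grammar m) → G ∈ grammars m
∈grammars []            = here refl
∈grammars (G ▷ (x , y)) = ∈-cartesianProductWith⁺ _▷_ (∈grammars G) (∈-cartesianProduct⁺ (∈symbols x) (∈symbols y))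

slpsWith : ∀ m → List SLP
slpsWith m = cartesianProductWith (slp m) (grammars m) (symbols m)

slpsUpTo : ℕ → List SLP
slpsUpTo zero    = slpsWith 0
slpsUpTo (suc s) = slpsWith (suc s) ++ slpsUpTo s

∈slpsUpTo : ∀ s (P : SLP) → nNT P ≤ s → P ∈ slpsUpTo s
∈slpsUpTo zero    (slp zero G x) z≤n = ∈-cartesianProductWith⁺ (slp 0) (∈grammars G) (∈symbols x)
∈slpsUpTo (suc s) (slp m G x) m≤1+s with m≤n⇒m<n∨m≡n m≤1+s
... | inj₂ refl      = ∈-++⁺ˡ (∈-cartesianProductWith⁺ (slp m) (∈grammars G) (∈symbols x))
... | inj₁ (s≤s m≤s) = ∈-++⁺ʳ (slpsWith (suc s)) (∈slpsUpTo s (slp m G x) m≤s)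

length-grammars : ∀ m → length (grammars m) ≤ (2 + m) ^ (2 * m)
length-grammars zero    = ≤-refl
length-grammars (suc m) = begin
  length (grammars (suc m))                 ≡⟨ length-cartesianProductWith _▷_ (grammars m) _ ⟩
  length (grammars m) * length (cartesianProduct (symbols m) (symbols m))
                                            ≡⟨ cong (length (grammars m) *_) pairs ⟩
  length (grammars m) * ((2 + m) * (2 + m)) ≤⟨ *-mono-≤ (≤-trans (length-grammars m) (^-monoˡ-≤ (2 * m) (n≤1+n (2 + m))))
                                                      (*-mono-≤ (n≤1+n (2 + m)) (n≤1+n (2 + m))) ⟩
  (3 + m) ^ (2 * m) * ((3 + m) * (3 + m))   ≡⟨ cong ((3 + m) ^ (2 * m) *_) (cong ((3 + m) *_) (*-identityʳ (3 + m))) ⟨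
  (3 + m) ^ (2 * m) * (3 + m) ^ 2           ≡⟨ ^-distribˡ-+-* (3 + m) (2 * m) 2 ⟨
  (3 + m) ^ (2 * m + 2)                     ≡⟨ cong ((3 + m) ^_) (2m+2≡2[1+m] m) ⟩
  (3 + m) ^ (2 * suc m)                     ∎
  where
  open ≤-Reasoning
  pairs : length (cartesianProduct (symbols m) (symbols m)) ≡ (2 + m) * (2 + m)
  pairs = trans (length-cartesianProductWith _,_ (symbols m) (symbols m)) (cong₂ _*_ (length-symbols m) (length-symbols m))
  2m+2≡2[1+m] : ∀ m → 2 * m + 2 ≡ 2 * suc m
  2m+2≡2[1+m] = solve-∀

length-slpsWith : ∀ m → length (slpsWith m) ≤ (2 + m) ^ suc (2 * m)
length-slpsWith m = begin
  length (slpsWith m)              ≡⟨ length-cartesianProductWith (slp m) (grammars m) (symbols m) ⟩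
  length (grammars m) * length (symbols m)
                                   ≡⟨ cong (length (grammars m) *_) (length-symbols m) ⟩
  length (grammars m) * (2 + m)    ≤⟨ *-monoˡ-≤ (2 + m) (length-grammars m) ⟩
  (2 + m) ^ (2 * m) * (2 + m)      ≡⟨ *-comm ((2 + m) ^ (2 * m)) (2 + m) ⟩
  (2 + m) ^ suc (2 * m)            ∎
  where open ≤-Reasoning

length-slpsUpTo : ∀ s → length (slpsUpTo s) ≤ (2 + s) ^ (2 * s + 2)
length-slpsUpTo zero    = s≤s (s≤s z≤n)
length-slpsUpTo (suc s) = begin
  length (slpsUpTo (suc s))                   ≡⟨ length-++ (slpsWith (suc s)) ⟩
  length (slpsWith (suc s)) + length (slpsUpTo s)
                                              ≤⟨ +-mono-≤ (length-slpsWith (suc s)) earlier ⟩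
  (3 + s) ^ e + (3 + s) ^ e                   ≡⟨ cong ((3 + s) ^ e +_) (+-identityʳ ((3 + s) ^ e)) ⟨
  2 * (3 + s) ^ e                             ≤⟨ *-monoˡ-≤ ((3 + s) ^ e) {2} {3 + s} (s≤s (s≤s z≤n)) ⟩
  (3 + s) ^ suc e                             ≡⟨ cong ((3 + s) ^_) (2+2[1+s]≡2[1+s]+2 s) ⟩
  (3 + s) ^ (2 * suc s + 2)                   ∎
  where
  open ≤-Reasoning
  e : ℕ
  e = suc (2 * suc s)
  earlier : length (slpsUpTo s) ≤ (3 + s) ^ e
  earlier = ≤-trans (length-slpsUpTo s)
            (≤-trans (^-monoˡ-≤ (2 * s + 2) (n≤1+n (2 + s)))
                     (^-monoʳ-≤ (3 + s) (≤-trans (n≤1+n (2 * s + 2)) (≤-reflexive (1+[2s+2]≡1+2[1+s] s)))))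
    where
    1+[2s+2]≡1+2[1+s] : ∀ s → suc (2 * s + 2) ≡ suc (2 * suc s)
    1+[2s+2]≡1+2[1+s] = solve-∀
  2+2[1+s]≡2[1+s]+2 : ∀ s → suc (suc (2 * suc s)) ≡ 2 * suc s + 2
  2+2[1+s]≡2[1+s]+2 = solve-∀

module _ {A B : Set} where

  ∈-─ : ∀ {x z : B} {ys} (x∈ : x ∈ ys) → z ∈ ys → z ≢ x → z ∈ ys ─ x∈
  ∈-─ (here refl) (here refl) z≢x = contradiction refl z≢x
  ∈-─ (here refl) (there z∈)  _   = z∈
  ∈-─ (there x∈)  (here refl) _   = here refl
  ∈-─ (there x∈)  (there z∈)  z≢x = there (∈-─ x∈ z∈ z≢x)

  injection⇒length≤ : ∀ (f : A → B) {xs ys} → Unique xs →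
                      (∀ {x y} → x ∈ xs → y ∈ xs → f x ≡ f y → x ≡ y) →
                      (∀ {x} → x ∈ xs → f x ∈ ys) → length xs ≤ length ys
  injection⇒length≤ f {[]}            _            _   _    = z≤n
  injection⇒length≤ f {x ∷ xs} {ys} (x∉xs ∷ uniq) inj into =
    subst (length (x ∷ xs) ≤_) (sym (length-removeAt′ ys _))
          (s≤s (injection⇒length≤ f uniq (λ x∈ y∈ → inj (there x∈) (there y∈)) into′))
    where
    fx∈ : f x ∈ ys
    fx∈ = into (here refl)
    into′ : ∀ {z} → z ∈ xs → f z ∈ ys ─ fx∈
    into′ z∈ = ∈-─ fx∈ (into (there z∈)) (λ fz≡fx → All.lookup x∉xs z∈ (inj (here refl) (there z∈) (sym fz≡fx)))

_≟Σ_ : DecidableEquality Σab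
a ≟Σ a = yes refl
a ≟Σ b = no λ ()
b ≟Σ a = no λ ()
b ≟Σ b = yes refl

open import Data.List.Membership.DecPropositional (≡-dec _≟Σ_) using (_∈?_)

incompressible : ∀ {n} J s → 4 ^ J ≤ n → length (slpsUpTo s) < length (digitVectors J) →
                 ∃ λ S → InSp n S × (∀ P → generated P ≡ S → s < nNT P)
incompressible {n} J s 4^J≤n fewer
  with all? (λ v → candidate n v ∈? map generated (slpsUpTo s)) (digitVectors J)
... | yes all-generated = contradiction fewer (≤⇒≯ (begin
      length (digitVectors J)                ≤⟨ injection⇒length≤ (candidate n) (digitVectors-unique J)
                                                  (candidate-injective J 4^J≤n) (All.lookup all-generated) ⟩
      length (map generated (slpsUpTo s))    ≡⟨ length-map generated (slpsUpTo s) ⟩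
      length (slpsUpTo s)                    ∎))
  where open ≤-Reasoning
... | no ¬all-generated =
  let (v , v∈ , v-not-generated) = find (¬All⇒Any¬ (λ v → candidate n v ∈? _) _ ¬all-generated)
  in candidate n v , candidate-InSp J v∈ , λ P P↦v → ≰⇒> λ nNT≤s →
       v-not-generated (subst (_∈ _) P↦v (∈-map⁺ generated (∈slpsUpTo s P nNT≤s)))

-- Choice of J and s

4^[⌊log₂n⌋/2]≤n : ∀ n → 0 < n → 4 ^ ⌊ ⌊log₂ n ⌋ /2⌋ ≤ n
4^[⌊log₂n⌋/2]≤n n 0<n = begin
  4 ^ ⌊ ⌊log₂ n ⌋ /2⌋        ≡⟨ 4^k≡2^[2k] ⌊ ⌊log₂ n ⌋ /2⌋ ⟩
  2 ^ (2 * ⌊ ⌊log₂ n ⌋ /2⌋)  ≤⟨ ^-monoʳ-≤ 2 (2*⌊n/2⌋≤n ⌊log₂ n ⌋) ⟩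
  2 ^ ⌊log₂ n ⌋              ≤⟨ 2^⌊log₂n⌋≤n n 0<n ⟩
  n                          ∎
  where open ≤-Reasoning

nNT≤size : ∀ P → nNT P ≤ size P
nNT≤size P = ≤-trans (m≤m+n (nNT P) _) (m≤m+n _ _)

exponent-gap : ∀ l s J → 1 ≤ l → l ≤ 2 * J + 1 → 100 * (s * l) ≤ (2 * J + 1) * (2 * J + 1) → 20 ≤ J →
               (suc l + suc l) * (2 * s + 2) < J * J
exponent-gap l s J 1≤l l≤2J+1 100sl≤ 20≤J = *-cancelˡ-≤ 100 (begin
  100 * suc ((suc l + suc l) * (2 * s + 2))        ≡⟨ expand l s ⟩
  400 * (s * l) + 400 * l + 400 * s + 500          ≤⟨ +-monoˡ-≤ 500 (+-mono-≤ (+-monoʳ-≤ (400 * (s * l)) (*-monoʳ-≤ 400 l≤2J+1))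
                                                                              (*-monoʳ-≤ 400 s≤sl)) ⟩
  400 * (s * l) + 400 * (2 * J + 1) + 400 * (s * l) + 500
                                                   ≡⟨ regroup (s * l) J ⟩
  8 * (100 * (s * l)) + 800 * J + 900              ≤⟨ +-monoˡ-≤ 900 (+-monoˡ-≤ (800 * J) (*-monoʳ-≤ 8 100sl≤)) ⟩
  8 * ((2 * J + 1) * (2 * J + 1)) + 800 * J + 900  ≡⟨ square J ⟩
  32 * (J * J) + (832 * J + 908)                   ≤⟨ +-monoʳ-≤ (32 * (J * J)) (+-monoʳ-≤ (832 * J)
                                                        (≤-trans (from-yes (908 ≤? 960)) (*-monoʳ-≤ 48 20≤J))) ⟩
  32 * (J * J) + (832 * J + 48 * J)                ≡⟨ collect J (J * J) ⟩
  32 * (J * J) + 44 * (20 * J)                     ≤⟨ +-monoʳ-≤ (32 * (J * J)) (*-monoʳ-≤ 44 (*-monoˡ-≤ J 20≤J)) ⟩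
  32 * (J * J) + 44 * (J * J)                      ≡⟨ collect′ (J * J) ⟩
  76 * (J * J)                                     ≤⟨ *-monoˡ-≤ (J * J) (from-yes (76 ≤? 100)) ⟩
  100 * (J * J)                                    ∎)
  where
  open ≤-Reasoning
  s≤sl : s ≤ s * l
  s≤sl = m≤m*n s l {{>-nonZero 1≤l}}
  expand : ∀ l s → 100 * suc ((suc l + suc l) * (2 * s + 2)) ≡ 400 * (s * l) + 400 * l + 400 * s + 500
  expand = solve-∀
  regroup : ∀ X J → 400 * X + 400 * (2 * J + 1) + 400 * X + 500 ≡ 8 * (100 * X) + 800 * J + 900
  regroup = solve-∀
  square : ∀ J → 8 * ((2 * J + 1) * (2 * J + 1)) + 800 * J + 900 ≡ 32 * (J * J) + (832 * J + 908)
  square = solve-∀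
  collect : ∀ J K → 32 * K + (832 * J + 48 * J) ≡ 32 * K + 44 * (20 * J)
  collect = solve-∀
  collect′ : ∀ K → 32 * K + 44 * K ≡ 76 * K
  collect′ = solve-∀

module Budget (L : ℕ) (40≤L : 40 ≤ L) where

  ℓ J : ℕ
  ℓ = ⌊log₂ L ⌋
  J = ⌊ L /2⌋

  1≤ℓ : 1 ≤ ℓ
  1≤ℓ = 2^k≤n⇒k≤⌊log₂n⌋ {1} (≤-trans (s≤s (s≤s z≤n)) 40≤L)

  instance
    100ℓ≢0 : NonZero (100 * ℓ)
    100ℓ≢0 = >-nonZero (≤-trans (s≤s z≤n) (*-monoʳ-≤ 100 1≤ℓ))

  s : ℕ
  s = L ^ 2 / (100 * ℓ)

  L≤2J+1 : L ≤ 2 * J + 1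
  L≤2J+1 = n≤2*⌊n/2⌋+1 L

  L^2≡L*L : L ^ 2 ≡ L * L
  L^2≡L*L = cong (L *_) (*-identityʳ L)

  2+s≤2^[2+2ℓ] : 2 + s ≤ 2 ^ (suc ℓ + suc ℓ)
  2+s≤2^[2+2ℓ] = begin
    2 + s                          ≤⟨ +-monoʳ-≤ 2 (≤-trans (m/n≤m (L ^ 2) (100 * ℓ)) (≤-reflexive L^2≡L*L)) ⟩
    2 + L * L                      ≤⟨ s≤s (+-mono-≤ (≤-trans (s≤s z≤n) 40≤L) (m≤n+m (L * L) L)) ⟩
    suc (L + (L + L * L))          ≡⟨ square L ⟨
    suc L * suc L                  ≤⟨ *-mono-≤ (n<2^[1+⌊log₂n⌋] L) (n<2^[1+⌊log₂n⌋] L) ⟩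
    2 ^ suc ℓ * 2 ^ suc ℓ          ≡⟨ ^-distribˡ-+-* 2 (suc ℓ) (suc ℓ) ⟨
    2 ^ (suc ℓ + suc ℓ)            ∎
    where
    open ≤-Reasoning
    square : ∀ L → suc L * suc L ≡ suc (L + (L + L * L))
    square = solve-∀

  100*[sℓ]≤[2J+1]² : 100 * (s * ℓ) ≤ (2 * J + 1) * (2 * J + 1)
  100*[sℓ]≤[2J+1]² = begin
    100 * (s * ℓ)                  ≡⟨ reassoc s ℓ ⟩
    s * (100 * ℓ)                  ≤⟨ m/n*n≤m (L ^ 2) (100 * ℓ) ⟩
    L ^ 2                          ≡⟨ L^2≡L*L ⟩
    L * L                          ≤⟨ *-mono-≤ L≤2J+1 L≤2J+1 ⟩
    (2 * J + 1) * (2 * J + 1)      ∎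
    where
    open ≤-Reasoning
    reassoc : ∀ s l → 100 * (s * l) ≡ s * (100 * l)
    reassoc = solve-∀

  slpsUpTo<digitVectors : length (slpsUpTo s) < length (digitVectors J)
  slpsUpTo<digitVectors = begin-strict
    length (slpsUpTo s)                     ≤⟨ length-slpsUpTo s ⟩
    (2 + s) ^ (2 * s + 2)                   ≤⟨ ^-monoˡ-≤ (2 * s + 2) 2+s≤2^[2+2ℓ] ⟩
    (2 ^ (suc ℓ + suc ℓ)) ^ (2 * s + 2)     ≡⟨ ^-*-assoc 2 (suc ℓ + suc ℓ) (2 * s + 2) ⟩
    2 ^ ((suc ℓ + suc ℓ) * (2 * s + 2))     <⟨ ^-monoʳ-< 2 (s≤s (s≤s z≤n)) gap ⟩
    2 ^ (J * J)                             ≡⟨ length-digitVectors J ⟨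
    length (digitVectors J)                 ∎
    where
    open ≤-Reasoning
    gap : (suc ℓ + suc ℓ) * (2 * s + 2) < J * J
    gap = exponent-gap ℓ s J 1≤ℓ (≤-trans (⌊log₂n⌋≤n L) L≤2J+1) 100*[sℓ]≤[2J+1]² (⌊n/2⌋-mono 40≤L)

  L^2≤100*[mℓ] : ∀ m → s < m → L ^ 2 ≤ 100 * (m * ℓ)
  L^2≤100*[mℓ] m s<m = <⇒≤ (begin-strict
    L ^ 2                <⟨ m<[1+m/n]*n (L ^ 2) (100 * ℓ) ⟩
    suc s * (100 * ℓ)    ≤⟨ *-monoˡ-≤ (100 * ℓ) s<m ⟩
    m * (100 * ℓ)        ≡⟨ reassoc m ℓ ⟩
    100 * (m * ℓ)        ∎)
    where
    open ≤-Reasoning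
    reassoc : ∀ m l → m * (100 * l) ≡ 100 * (m * l)
    reassoc = solve-∀

hard-member : ∀ n → 0 < n → 40 ≤ ⌊log₂ n ⌋ →
  ∃ λ S → InSp n S × (∀ P → generated P ≡ S → ⌊log₂ n ⌋ ^ 2 ≤ 100 * (size P * ⌊log₂ ⌊log₂ n ⌋ ⌋))
hard-member n 0<n 40≤L =
  let open Budget ⌊log₂ n ⌋ 40≤L
      (S , S∈Sᵖₙ , needs-more-than-s) = incompressible J s (4^[⌊log₂n⌋/2]≤n n 0<n) slpsUpTo<digitVectors
  in S , S∈Sᵖₙ , λ P P↦S → L^2≤100*[mℓ] (size P) (<-≤-trans (needs-more-than-s P P↦S) (nNT≤size P))

corollary1 : ∃ λ (K : ℕ) → ∃ λ (N : ℕ) → (0 < K) × (∀ n → N ≤ n →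
    ∃ λ (S : Str) → InSp n S × (∀ (P : SLP) → generated P ≡ S →
    ⌊log₂ n ⌋ ^ 2 ≤ K * (size P * ⌊log₂ ⌊log₂ n ⌋ ⌋)))
corollary1 = 100 , 2 ^ 40 , z<s , λ n 2^40≤n →
  hard-member n (≤-trans (m^n>0 2 40) 2^40≤n) (2^k≤n⇒k≤⌊log₂n⌋ {40} 2^40≤n)
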